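{- Let $E$ be a finite set and let $(E,\mathcal{F})$ be an accessible set system; put $\mathcal{F}^{+}=\mathcal{F}-\{\varnothing\}$. For a function $F:\mathcal{F}^{+}\to\mathbf{R}$ define $\pi_F(x,X)=\max_{A\in[x,X]_{\mathcal{F}}}F(A)$ if $x\in X$ and $[x,X]_{\mathcal{F}}\neq\varnothing$, and $\pi_F(x,X)=\min_{A\in\mathcal{F}^{+}}F(A)$ otherwise, where $[x,X]_{\mathcal{F}}=\{A\in\mathcal{F}^{+}: x\in A,\ A\subseteq X\}$; and define $G_F(X)=\min_{x\in ex(X)}\pi_F(x,X)$ for $X\in\mathcal{F}^{+}$. Then the following are equivalent: (a) for every quasi-concave function $F:\mathcal{F}^{+}\to\mathbf{R}$ one has $G_F=F$ on $\mathcal{F}^{+}$; (b) $(E,\mathcal{F})$ satisfies the chain property.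
   Context: A nonempty set system $(E,\mathcal{F})$ is accessible if for every nonempty $X\in\mathcal{F}$ there is $x\in X$ with $X-\{x\}\in\mathcal{F}$. For $X\in\mathcal{F}$, $ex(X)=\{x\in X: X-\{x\}\in\mathcal{F}\}$. A cover of a set $X\subseteq E$ is a minimal (with respect to inclusion) member of $\mathcal{F}$ containing $X$; $\mathcal{C}(X)$ denotes the family of covers of $X$. A function $F$ on $\mathcal{F}^{+}$ is quasi-concave if for all $X,Y$ in its domain and every $Z\in\mathcal{C}(X\cup Y)$, $F(Z)\geq\min\{F(X),F(Y)\}$. The chain property: for all $X,Y\in\mathcal{F}$ with $X\subset Y$ (proper) there exists $y\in Y-X$ with $Y-\{y\}\in\mathcal{F}$.
   Formalization: The quasi-concave functions F in clause (a) take values in ℚ rather than ℝ. -}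

module Defs where

open import Data.Bool using (Bool; true; false; T; T?; _∧_; if_then_else_)
open import Data.Nat using (ℕ; zero; suc)
open import Data.Fin using (Fin)
open import Data.Fin.Subset using (Subset; _∈_; _∉_; _⊆_; _⊂_; _∪_; _─_; ⁅_⁆; Nonempty)
open import Data.Fin.Subset.Properties using (_∈?_; _⊆?_; nonempty?)
open import Data.List using (List; []; _∷_; map; filterᵇ; foldr; _++_; allFin)
import Data.List as L
open import Data.Vec using (Vec; []; _∷_)
open import Data.Product using (Σ; ∃; _×_; _,_)
open import Data.Rational using (ℚ; 0ℚ; _⊔_; _⊓_; _≤_)
open import Relation.Nullary using (does)
open import Relation.Binary.PropositionalEquality using (_≡_)

-- The ground set E is Fin n; a set system on E is a decidable family of subsets,
-- given by its characteristic function.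
Fam : ℕ → Set
Fam n = Subset n → Bool

module _ {n : ℕ} where

  _∈𝓕_ : Subset n → Fam n → Set
  X ∈𝓕 𝓕 = T (𝓕 X)

  _∈𝓕⁺_ : Subset n → Fam n → Set
  X ∈𝓕⁺ 𝓕 = X ∈𝓕 𝓕 × Nonempty X

  NonemptySystem : Fam n → Set
  NonemptySystem 𝓕 = ∃ λ X → X ∈𝓕 𝓕

  Accessible : Fam n → Set
  Accessible 𝓕 = ∀ X → X ∈𝓕 𝓕 → Nonempty X →
    ∃ λ x → x ∈ X × (X ─ ⁅ x ⁆) ∈𝓕 𝓕

  IsCover : Fam n → Subset n → Subset n → Set
  IsCover 𝓕 X Z = Z ∈𝓕 𝓕 × X ⊆ Z ×
    (∀ W → W ∈𝓕 𝓕 → X ⊆ W → W ⊆ Z → W ≡ Z)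

  -- quasi-concave function on 𝓕⁺ (values outside 𝓕⁺ are irrelevant)
  QuasiConcave : Fam n → (Subset n → ℚ) → Set
  QuasiConcave 𝓕 F = ∀ X Y → X ∈𝓕⁺ 𝓕 → Y ∈𝓕⁺ 𝓕 →
    ∀ Z → IsCover 𝓕 (X ∪ Y) Z → (F X ⊓ F Y) ≤ F Z

  ChainProperty : Fam n → Set
  ChainProperty 𝓕 = ∀ X Y → X ∈𝓕 𝓕 → Y ∈𝓕 𝓕 → X ⊂ Y →
    ∃ λ y → y ∈ Y × y ∉ X × (Y ─ ⁅ y ⁆) ∈𝓕 𝓕

allSubsets : ∀ n → List (Subset n)
allSubsets zero = [] ∷ []
allSubsets (suc n) = map (true ∷_) (allSubsets n) ++ map (false ∷_) (allSubsets n)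

-- max / min of a list (the default 0ℚ for the empty list is never used
-- in the theorem: all lists below are nonempty whenever they are evaluated)
maxL : List ℚ → ℚ
maxL [] = 0ℚ
maxL (a ∷ as) = foldr _⊔_ a as

minL : List ℚ → ℚ
minL [] = 0ℚ
minL (a ∷ as) = foldr _⊓_ a as

module _ {n : ℕ} (𝓕 : Fam n) where

  𝓕⁺list : List (Subset n)
  𝓕⁺list = filterᵇ (λ A → does (nonempty? A)) (filterᵇ (λ A → (𝓕 A)) (allSubsets n))

  interval : Fin n → Subset n → List (Subset n)
  interval x X = filterᵇ (λ A → does (x ∈? A)) (filterᵇ (λ A → does (A ⊆? X)) 𝓕⁺list)

  πF : (Subset n → ℚ) → Fin n → Subset n → ℚ
  πF F x X with does (x ∈? X) | interval x X
  ... | true  | A ∷ As = maxL (map F (A ∷ As))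
  ... | true  | []     = minL (map F 𝓕⁺list)
  ... | false | _      = minL (map F 𝓕⁺list)

  exList : Subset n → List (Fin n)
  exList X = filterᵇ (λ x → does (x ∈? X)) (filterᵇ (λ x → (𝓕 (X ─ ⁅ x ⁆))) (allFin n))

  GF : (Subset n → ℚ) → Subset n → ℚ
  GF F X = minL (map (λ x → πF F x X) (exList X))

{-# OPTIONS --safe #-}
-- Since X ∈ [x, X] for every x ∈ ex(X), always G_F(X) ≥ F(X). If G_F(X) > F(X), every
-- y ∈ ex(X) lies in a set A_y ⊆ X of 𝓕⁺ with F(A_y) > F(X). For such a set B ⊂ X, the chain
-- property gives y ∈ X - B with X - {y} ∈ 𝓕, and by quasi-concavity a cover of B ∪ A_y inside X
-- is again such a set, strictly containing B; this ascent inside the finite set X must stop.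
-- Conversely, for X ⊂ Y apply G_F = F at Y to the indicator function F of {X}: if ex(Y) ⊆ X,
-- then X ∈ [x, Y] for every x ∈ ex(Y), so G_F(Y) = 1, while F(Y) = 0.
module Submission where

open import Defs
open import Data.Nat using (ℕ; zero; suc; _∸_) renaming (_<_ to _<ₙ_)
open import Data.Bool using (true; false; T; if_then_else_)
open import Data.Nat.Induction using (<-wellFounded)
open import Data.Nat.Properties using (∸-monoʳ-<)
open import Data.Bool.Properties using () renaming (_≟_ to _≟ᵇ_)
open import Data.Vec using ([]; _∷_)
open import Data.Vec.Properties using (≡-dec)
open import Data.Fin.Properties using (any?)
open import Data.Fin.Subset using (Subset; _∈_; _⊆_; _⊂_; _∪_; _─_; ⁅_⁆; ∣_∣)
open import Data.Fin.Subset.Properties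
  using (_∈?_; _⊆?_; _⊂?_; nonempty?; anySubset?; ⊆-refl; ⊆-trans; ⊆-antisym;
         p⊆p∪q; q⊆p∪q; x∈p∪q⁻; p⊂q⇒∣p∣<∣q∣; ∣p∣≤n)
open import Data.List using ([]; _∷_; map; filterᵇ; allFin)
open import Data.List.Properties using (foldr-preservesᵇ; foldr-preservesᵒ)
open import Data.List.Membership.Propositional using (find; lose) renaming (_∈_ to _∈ₗ_)
open import Data.List.Membership.Propositional.Properties
  using (∈-filter⁺; ∈-filter⁻; ∈-map⁺; ∈-++⁺ˡ; ∈-++⁺ʳ; ∈-allFin)
open import Data.List.Relation.Unary.All as All using (All; _∷_)
open import Data.List.Relation.Unary.All.Properties using () renaming (map⁺ to All-map⁺)
open import Data.List.Relation.Unary.Any as Any using (here; there)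
open import Data.Product using (∃; _×_; _,_; proj₁; proj₂)
open import Data.Sum using (_⊎_; inj₁; inj₂; [_,_]′)
open import Data.Rational using (ℚ; 0ℚ; 1ℚ; _⊔_; _⊓_; _≤_; _<_)
open import Data.Rational.Properties
  using (≤-refl; ≤-reflexive; ≤-trans; ≤-antisym; <-≤-trans; <⇒≢; ≮⇒≥; _≤?_; _<?_;
         ⊔-lub; ⊓-glb; ⊓-sel; p≤p⊔q; p≤q⊔p; p⊓q≤p; p⊓q≤q)
open import Function using (_∘_; flip)
open import Function.Bundles using (_⇔_; mk⇔)
open import Induction.WellFounded using (WellFounded; Acc; acc; module Subrelation)
import Relation.Binary.Construct.On as On
open import Relation.Nullary using (¬_; Dec; yes; no; does; contradiction)
open import Relation.Nullary.Decidable using (toWitness; fromWitness; from-yes; from-no; isYes≗does; decidable-stable; _×-dec_; ¬?; T?)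
open import Relation.Unary using (Decidable)
open import Relation.Binary.PropositionalEquality using (_≡_; _≢_; refl; sym; trans; cong; subst)

module _ {A : Set} {P : A → Set} (P? : Decidable P) where

  ∈-filterᵇ⁻ : ∀ {x xs} → x ∈ₗ filterᵇ (does ∘ P?) xs → x ∈ₗ xs × P x
  ∈-filterᵇ⁻ {x} x∈ =
    let x∈xs , Px = ∈-filter⁻ (T? ∘ does ∘ P?) x∈
    in x∈xs , toWitness (subst T (sym (isYes≗does (P? x))) Px)

  ∈-filterᵇ⁺ : ∀ {x xs} → x ∈ₗ xs → P x → x ∈ₗ filterᵇ (does ∘ P?) xs
  ∈-filterᵇ⁺ {x} x∈xs Px =
    ∈-filter⁺ (T? ∘ does ∘ P?) x∈xs (subst T (isYes≗does (P? x)) (fromWitness Px))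

∈∷⇒⊎Any : ∀ {A : Set} {P : A → Set} {a b bs} → a ∈ₗ b ∷ bs → P a → P b ⊎ Any.Any P bs
∈∷⇒⊎Any (here refl)  Pa = inj₁ Pa
∈∷⇒⊎Any (there a∈bs) Pa = inj₂ (lose a∈bs Pa)

≤maxL : ∀ {a as} → a ∈ₗ as → a ≤ maxL as
≤maxL {a} {b ∷ bs} a∈ = foldr-preservesᵒ ≤⊔ b bs (∈∷⇒⊎Any a∈ ≤-refl)
  where
  ≤⊔ : ∀ x y → a ≤ x ⊎ a ≤ y → a ≤ x ⊔ y
  ≤⊔ x y = [ (λ a≤x → ≤-trans a≤x (p≤p⊔q x y)) , (λ a≤y → ≤-trans a≤y (p≤q⊔p x y)) ]′

maxL≤ : ∀ {a as q} → a ∈ₗ as → All (_≤ q) as → maxL as ≤ q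
maxL≤ {as = b ∷ bs} _ (b≤q ∷ bs≤q) = foldr-preservesᵇ ⊔-lub b≤q bs≤q

minL≤ : ∀ {a as} → a ∈ₗ as → minL as ≤ a
minL≤ {a} {b ∷ bs} a∈ = foldr-preservesᵒ ⊓≤ b bs (∈∷⇒⊎Any a∈ ≤-refl)
  where
  ⊓≤ : ∀ x y → x ≤ a ⊎ y ≤ a → x ⊓ y ≤ a
  ⊓≤ x y = [ (λ x≤a → ≤-trans (p⊓q≤p x y) x≤a) , (λ y≤a → ≤-trans (p⊓q≤q x y) y≤a) ]′

≤minL : ∀ {a as q} → a ∈ₗ as → All (q ≤_) as → q ≤ minL as
≤minL {as = b ∷ bs} _ (q≤b ∷ q≤bs) = foldr-preservesᵇ ⊓-glb q≤b q≤bs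

<⊓ : ∀ {p q r : ℚ} → p < q → p < r → p < q ⊓ r
<⊓ {p} {q} {r} p<q p<r with ⊓-sel q r
... | inj₁ q⊓r≡q = subst (p <_) (sym q⊓r≡q) p<q
... | inj₂ q⊓r≡r = subst (p <_) (sym q⊓r≡r) p<r

∈-allSubsets : ∀ n (A : Subset n) → A ∈ₗ allSubsets n
∈-allSubsets zero [] = here refl
∈-allSubsets (suc n) (true ∷ A) = ∈-++⁺ˡ (∈-map⁺ (true ∷_) (∈-allSubsets n A))
∈-allSubsets (suc n) (false ∷ A) =
  ∈-++⁺ʳ (map (true ∷_) (allSubsets n)) (∈-map⁺ (false ∷_) (∈-allSubsets n A))

module _ {n : ℕ} where

  _≟ₛ_ : (p q : Subset n) → Dec (p ≡ q)
  _≟ₛ_ = ≡-dec _≟ᵇ_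

  ∪-least : ∀ {p q r : Subset n} → p ⊆ r → q ⊆ r → p ∪ q ⊆ r
  ∪-least {p} {q} p⊆r q⊆r x∈p∪q = [ p⊆r , q⊆r ]′ (x∈p∪q⁻ p q x∈p∪q)

  ⊆∧⊄⇒≡ : ∀ {p q : Subset n} → p ⊆ q → ¬ p ⊂ q → p ≡ q
  ⊆∧⊄⇒≡ {p} {q} p⊆q p⊄q = ⊆-antisym p⊆q q⊆p
    where
    q⊆p : q ⊆ p
    q⊆p {y} y∈q = decidable-stable (y ∈? p) (λ y∉p → p⊄q (p⊆q , y , y∈q , y∉p))

  ⊂-wellFounded : WellFounded (_⊂_ {n})
  ⊂-wellFounded =
    Subrelation.wellFounded p⊂q⇒∣p∣<∣q∣ (On.wellFounded ∣_∣ <-wellFounded)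

  ⊃-wellFounded : WellFounded (flip (_⊂_ {n}))
  ⊃-wellFounded = Subrelation.wellFounded ∣⊂∣ (On.wellFounded (λ p → n ∸ ∣ p ∣) <-wellFounded)
    where
    ∣⊂∣ : ∀ {p q : Subset n} → q ⊂ p → n ∸ ∣ p ∣ <ₙ n ∸ ∣ q ∣
    ∣⊂∣ {p} q⊂p = ∸-monoʳ-< (p⊂q⇒∣p∣<∣q∣ q⊂p) (∣p∣≤n p)

  no-⊂-ascent : (P : Subset n → Set) → (∀ {B} → P B → ∃ λ Z → P Z × B ⊂ Z) → ∀ {B} → ¬ P B
  no-⊂-ascent P ascend = climb (⊃-wellFounded _)
    where
    climb : ∀ {B} → Acc (flip _⊂_) B → ¬ P B
    climb (acc above) PB = let _ , PZ , B⊂Z = ascend PB in climb (above B⊂Z) PZ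

  indicator : Subset n → Subset n → ℚ
  indicator X A = if does (A ≟ₛ X) then 1ℚ else 0ℚ

  indicator-self : ∀ X → indicator X X ≡ 1ℚ
  indicator-self X with X ≟ₛ X
  ... | yes _    = refl
  ... | no X≢X   = contradiction refl X≢X

  indicator-≢ : ∀ {X A} → A ≢ X → indicator X A ≡ 0ℚ
  indicator-≢ {X} {A} A≢X with A ≟ₛ X
  ... | yes A≡X = contradiction A≡X A≢X
  ... | no _    = refl

  0≤indicator : ∀ X A → 0ℚ ≤ indicator X A
  0≤indicator X A with A ≟ₛ X
  ... | yes _ = from-yes (0ℚ ≤? 1ℚ)
  ... | no _  = ≤-refl

module _ {n : ℕ} (𝓕 : Fam n) where

  ∈-exList⁻ : ∀ {x X} → x ∈ₗ exList 𝓕 X → x ∈ X × (X ─ ⁅ x ⁆) ∈𝓕 𝓕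
  ∈-exList⁻ {x} {X} x∈ex =
    let x∈₁ , x∈X = ∈-filterᵇ⁻ (_∈? X) {xs = filterᵇ (λ y → 𝓕 (X ─ ⁅ y ⁆)) (allFin n)} x∈ex
        _ , X-x∈𝓕 = ∈-filter⁻ (λ y → T? (𝓕 (X ─ ⁅ y ⁆))) {xs = allFin n} x∈₁
    in x∈X , X-x∈𝓕

  ∈-exList⁺ : ∀ {x X} → x ∈ X → (X ─ ⁅ x ⁆) ∈𝓕 𝓕 → x ∈ₗ exList 𝓕 X
  ∈-exList⁺ {x} {X} x∈X X-x∈𝓕 =
    ∈-filterᵇ⁺ (_∈? X) (∈-filter⁺ (λ y → T? (𝓕 (X ─ ⁅ y ⁆))) (∈-allFin x) X-x∈𝓕) x∈X

  -- filter is not injective, so the intermediate lists (and below, the point x of an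
  -- interval) cannot be inferred from a membership proof and are given explicitly.
  ∈-interval⁻ : ∀ {A x X} → A ∈ₗ interval 𝓕 x X → A ∈𝓕⁺ 𝓕 × A ⊆ X × x ∈ A
  ∈-interval⁻ {A} {x} {X} A∈I =
    let A∈₁ , x∈A = ∈-filterᵇ⁻ (x ∈?_) {xs = filterᵇ (λ B → does (B ⊆? X)) (𝓕⁺list 𝓕)} A∈I
        A∈₂ , A⊆X = ∈-filterᵇ⁻ (_⊆? X) {xs = 𝓕⁺list 𝓕} A∈₁
        A∈₃ , A≢∅ = ∈-filterᵇ⁻ nonempty? {xs = filterᵇ 𝓕 (allSubsets n)} A∈₂
        _ , A∈𝓕 = ∈-filter⁻ (T? ∘ 𝓕) {xs = allSubsets n} A∈₃
    in (A∈𝓕 , A≢∅) , A⊆X , x∈A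

  ∈-interval⁺ : ∀ {A x X} → A ∈𝓕⁺ 𝓕 → A ⊆ X → x ∈ A → A ∈ₗ interval 𝓕 x X
  ∈-interval⁺ {A} {x} {X} (A∈𝓕 , A≢∅) A⊆X x∈A =
    ∈-filterᵇ⁺ (x ∈?_) (∈-filterᵇ⁺ (_⊆? X) (∈-filterᵇ⁺ nonempty?
      (∈-filter⁺ (T? ∘ 𝓕) (∈-allSubsets n A) A∈𝓕) A≢∅) A⊆X) x∈A

  module _ (F : Subset n → ℚ) where

    πF≡maxL : ∀ {A x X} → A ∈ₗ interval 𝓕 x X → πF 𝓕 F x X ≡ maxL (map F (interval 𝓕 x X))
    πF≡maxL {x = x} {X} A∈I =
      let _ , A⊆X , x∈A = ∈-interval⁻ A∈I in unfold (A⊆X x∈A) A∈I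
      where
      unfold : ∀ {A} → x ∈ X → A ∈ₗ interval 𝓕 x X →
               πF 𝓕 F x X ≡ maxL (map F (interval 𝓕 x X))
      unfold x∈X A∈I with x ∈? X | interval 𝓕 x X
      ... | no x∉X | _     = contradiction x∈X x∉X
      ... | yes _  | _ ∷ _ = refl
      ... | yes _  | []    with () ← A∈I

    ≤πF : ∀ {A x X} → A ∈ₗ interval 𝓕 x X → F A ≤ πF 𝓕 F x X
    ≤πF {A} {x} A∈I = subst (F A ≤_) (sym (πF≡maxL {x = x} A∈I)) (≤maxL (∈-map⁺ F A∈I))

    πF≤ : ∀ {A x X q} → A ∈ₗ interval 𝓕 x X → (∀ {B} → B ∈ₗ interval 𝓕 x X → F B ≤ q) →
          πF 𝓕 F x X ≤ q
    πF≤ {x = x} {q = q} A∈I bound =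
      subst (_≤ q) (sym (πF≡maxL {x = x} A∈I)) (maxL≤ (∈-map⁺ F A∈I) (All-map⁺ (All.tabulate bound)))

    GF≤πF : ∀ {x X} → x ∈ₗ exList 𝓕 X → GF 𝓕 F X ≤ πF 𝓕 F x X
    GF≤πF {x} {X} x∈ex = minL≤ (∈-map⁺ (λ y → πF 𝓕 F y X) x∈ex)

    ≤GF : ∀ {x X q} → x ∈ₗ exList 𝓕 X → (∀ {y} → y ∈ₗ exList 𝓕 X → q ≤ πF 𝓕 F y X) →
          q ≤ GF 𝓕 F X
    ≤GF {X = X} x∈ex bound =
      ≤minL (∈-map⁺ (λ y → πF 𝓕 F y X) x∈ex) (All-map⁺ (All.tabulate bound))

  ∃-cover-⊆ : ∀ {C W} → W ∈𝓕 𝓕 → C ⊆ W → ∃ λ Z → IsCover 𝓕 C Z × Z ⊆ W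
  ∃-cover-⊆ {C} {W} = descend (⊂-wellFounded W)
    where
    descend : ∀ {W} → Acc _⊂_ W → W ∈𝓕 𝓕 → C ⊆ W → ∃ λ Z → IsCover 𝓕 C Z × Z ⊆ W
    descend {W} (acc below) W∈𝓕 C⊆W
      with anySubset? (λ V → T? (𝓕 V) ×-dec C ⊆? V ×-dec V ⊂? W)
    ... | yes (V , V∈𝓕 , C⊆V , V⊂W) =
      let Z , Z-cover , Z⊆V = descend (below V⊂W) V∈𝓕 C⊆V
      in Z , Z-cover , ⊆-trans Z⊆V (proj₁ V⊂W)
    ... | no ∄V = W , (W∈𝓕 , C⊆W , minimal) , ⊆-refl
      where
      minimal : ∀ V → V ∈𝓕 𝓕 → C ⊆ V → V ⊆ W → V ≡ W
      minimal V V∈𝓕 C⊆V V⊆W = ⊆∧⊄⇒≡ V⊆W (λ V⊂W → ∄V (V , V∈𝓕 , C⊆V , V⊂W))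

  ∃-exList : ∀ {X} → Accessible 𝓕 → X ∈𝓕⁺ 𝓕 → ∃ λ x → x ∈ₗ exList 𝓕 X
  ∃-exList access (X∈𝓕 , X≢∅) =
    let x , x∈X , X-x∈𝓕 = access _ X∈𝓕 X≢∅ in x , ∈-exList⁺ x∈X X-x∈𝓕

  F≤GF : ∀ {F X} → Accessible 𝓕 → X ∈𝓕⁺ 𝓕 → F X ≤ GF 𝓕 F X
  F≤GF {F} access X∈𝓕⁺ =
    ≤GF F (proj₂ (∃-exList access X∈𝓕⁺))
      (λ {y} y∈ex → ≤πF F {x = y} (∈-interval⁺ X∈𝓕⁺ ⊆-refl (proj₁ (∈-exList⁻ y∈ex))))

  Above : (Subset n → ℚ) → Subset n → Subset n → Set
  Above F X B = B ∈𝓕⁺ 𝓕 × B ⊆ X × F X < F B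

  Above-ascent : ∀ {F X} → ChainProperty 𝓕 → QuasiConcave 𝓕 F → X ∈𝓕 𝓕 →
                 (∀ {y} → y ∈ X → (X ─ ⁅ y ⁆) ∈𝓕 𝓕 → ∃ λ A → Above F X A × y ∈ A) →
                 ∀ {B} → Above F X B → ∃ λ Z → Above F X Z × B ⊂ Z
  Above-ascent {F} {X} chain qc X∈𝓕 up {B} (B∈𝓕⁺@(B∈𝓕 , _) , B⊆X , FX<FB) with B ⊂? X
  ... | no B⊄X = contradiction (cong F (sym (⊆∧⊄⇒≡ B⊆X B⊄X))) (<⇒≢ FX<FB)
  ... | yes B⊂X =
    let y , y∈X , y∉B , X-y∈𝓕 = chain B X B∈𝓕 X∈𝓕 B⊂X
        A , (A∈𝓕⁺ , A⊆X , FX<FA) , y∈A = up y∈X X-y∈𝓕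
        Z , Z-cover@(Z∈𝓕 , B∪A⊆Z , _) , Z⊆X = ∃-cover-⊆ X∈𝓕 (∪-least B⊆X A⊆X)
        y∈Z = B∪A⊆Z (q⊆p∪q B A y∈A)
    in Z , ((Z∈𝓕 , y , y∈Z) , Z⊆X , <-≤-trans (<⊓ FX<FB FX<FA) (qc B A B∈𝓕⁺ A∈𝓕⁺ Z Z-cover))
         , (⊆-trans (p⊆p∪q A) B∪A⊆Z , y , y∈Z , y∉B)

  GF≤F : ∀ {F X} → Accessible 𝓕 → ChainProperty 𝓕 → QuasiConcave 𝓕 F → X ∈𝓕⁺ 𝓕 → GF 𝓕 F X ≤ F X
  GF≤F {F} {X} access chain qc X∈𝓕⁺@(X∈𝓕 , X≢∅)
    with any? (λ x → x ∈? X ×-dec T? (𝓕 (X ─ ⁅ x ⁆)) ×-dec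
                     ¬? (Any.any? (λ A → F X <? F A) (interval 𝓕 x X)))
  ... | yes (x , x∈X , X-x∈𝓕 , ∄A) =
    ≤-trans (GF≤πF F (∈-exList⁺ x∈X X-x∈𝓕))
            (πF≤ F {x = x} (∈-interval⁺ X∈𝓕⁺ ⊆-refl x∈X) (λ A∈I → ≮⇒≥ (∄A ∘ lose A∈I)))
  ... | no ∄x =
    let x₀ , x₀∈X , X-x₀∈𝓕 = access X X∈𝓕 X≢∅
        _ , A₀-above , _ = up x₀∈X X-x₀∈𝓕
    in contradiction A₀-above (no-⊂-ascent (Above F X) (Above-ascent chain qc X∈𝓕 up))
    where
    up : ∀ {y} → y ∈ X → (X ─ ⁅ y ⁆) ∈𝓕 𝓕 → ∃ λ A → Above F X A × y ∈ A
    up {y} y∈X X-y∈𝓕 =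
      let A , A∈I , FX<FA = find (decidable-stable (Any.any? (λ A → F X <? F A) (interval 𝓕 y X))
                                    (λ ∄A → ∄x (y , y∈X , X-y∈𝓕 , ∄A)))
          A∈𝓕⁺ , A⊆X , y∈A = ∈-interval⁻ {x = y} A∈I
      in A , (A∈𝓕⁺ , A⊆X , FX<FA) , y∈A

  indicator-quasiConcave : ∀ X → QuasiConcave 𝓕 (indicator X)
  indicator-quasiConcave X A B (A∈𝓕 , _) _ Z (_ , A∪B⊆Z , minimal) = bound (A ≟ₛ X) (B ≟ₛ X)
    where
    vanishing≤ : ∀ {W} → W ≢ X → indicator X W ≤ indicator X Z
    vanishing≤ W≢X = subst (_≤ indicator X Z) (sym (indicator-≢ W≢X)) (0≤indicator X Z)

    bound : Dec (A ≡ X) → Dec (B ≡ X) → indicator X A ⊓ indicator X B ≤ indicator X Z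
    bound (yes refl) (yes refl) =
      let X≡Z = minimal X A∈𝓕 (∪-least ⊆-refl ⊆-refl) (⊆-trans (p⊆p∪q X) A∪B⊆Z)
      in ≤-trans (p⊓q≤p _ _) (≤-reflexive (cong (indicator X) X≡Z))
    bound _          (no B≢X) = ≤-trans (p⊓q≤q (indicator X A) _) (vanishing≤ B≢X)
    bound (no A≢X)   _        = ≤-trans (p⊓q≤p _ (indicator X B)) (vanishing≤ A≢X)

  chainProperty : Accessible 𝓕 →
                  (∀ F → QuasiConcave 𝓕 F → ∀ X → X ∈𝓕⁺ 𝓕 → GF 𝓕 F X ≡ F X) →
                  ChainProperty 𝓕
  chainProperty access GF≡F X Y X∈𝓕 Y∈𝓕 (X⊆Y , y , y∈Y , y∉X)
    with any? (λ z → z ∈? Y ×-dec ¬? (z ∈? X) ×-dec T? (𝓕 (Y ─ ⁅ z ⁆)))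
  ... | yes found = found
  ... | no ∄z = contradiction (subst (1ℚ ≤_) GF≡0 1≤GF) (from-no (1ℚ ≤? 0ℚ))
    where
    Y∈𝓕⁺ : Y ∈𝓕⁺ 𝓕
    Y∈𝓕⁺ = Y∈𝓕 , y , y∈Y

    1≤πF : ∀ {z} → z ∈ₗ exList 𝓕 Y → 1ℚ ≤ πF 𝓕 (indicator X) z Y
    1≤πF {z} z∈ex =
      let z∈Y , Y-z∈𝓕 = ∈-exList⁻ z∈ex
          z∈X = decidable-stable (z ∈? X) (λ z∉X → ∄z (z , z∈Y , z∉X , Y-z∈𝓕))
      in subst (_≤ πF 𝓕 (indicator X) z Y) (indicator-self X)
           (≤πF (indicator X) {x = z} (∈-interval⁺ (X∈𝓕 , z , z∈X) X⊆Y z∈X))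

    1≤GF : 1ℚ ≤ GF 𝓕 (indicator X) Y
    1≤GF = ≤GF (indicator X) (proj₂ (∃-exList access Y∈𝓕⁺)) 1≤πF

    GF≡0 : GF 𝓕 (indicator X) Y ≡ 0ℚ
    GF≡0 = trans (GF≡F (indicator X) (indicator-quasiConcave X) Y Y∈𝓕⁺)
                 (indicator-≢ (λ Y≡X → y∉X (subst (y ∈_) Y≡X y∈Y)))

mainTheorem5 : (n : ℕ) (𝓕 : Fam n) → NonemptySystem 𝓕 → Accessible 𝓕 →
    ((∀ (F : Subset n → ℚ) → QuasiConcave 𝓕 F →
        ∀ X → X ∈𝓕⁺ 𝓕 → GF 𝓕 F X ≡ F X)
     ⇔ ChainProperty 𝓕)
mainTheorem5 n 𝓕 _ access = mk⇔ (chainProperty 𝓕 access) GF≡F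
  where
  GF≡F : ChainProperty 𝓕 → ∀ F → QuasiConcave 𝓕 F → ∀ X → X ∈𝓕⁺ 𝓕 → GF 𝓕 F X ≡ F X
  GF≡F chain F qc X X∈𝓕⁺ = ≤-antisym (GF≤F 𝓕 access chain qc X∈𝓕⁺) (F≤GF 𝓕 access X∈𝓕⁺)
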